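{- Let $i$ be an agent, $G_1,\dots,G_n,H$ groups ($n\geq 1$), $\mathfrak{M}=(S,\sim,V)$ a model, and $\mathfrak{M}|_{G_1}|\cdots|_{G_n}=(S,\sim|_{G_1}|\cdots|_{G_n},V)$ the model obtained by successively applying the $G_1$-, \dots, $G_n$-resolved updates. Then for every formula $\phi$ of $\mathcal{RCD}$: (1) $R_{G_1}\cdots R_{G_n}K_i\phi\leftrightarrow D_{\delta(\{i\},G_1,\dots,G_n)}R_{G_1}\cdots R_{G_n}\phi$ is valid; (2) $R_{G_1}\cdots R_{G_n}D_H\phi\leftrightarrow D_{\delta(H,G_1,\dots,G_n)}R_{G_1}\cdots R_{G_n}\phi$ is valid; (3) $(\sim|_{G_1}|\cdots|_{G_n})_i=\sim_{\delta(\{i\},G_1,\dots,G_n)}$; (4) $(\sim|_{G_1}|\cdots|_{G_n})_H=\sim_{\delta(H,G_1,\dots,G_n)}$.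
   Context: Fix a countable set $\textsc{prop}$ of propositional variables and a finite set $\textsc{ag}$ of agents; groups are nonempty subsets of $\textsc{ag}$. The language $\mathcal{RCD}$ is $\phi ::= p \mid \neg\phi \mid \phi\wedge\phi \mid K_i\phi \mid D_G\phi \mid C_G\phi \mid R_G\phi$. A model is $\mathfrak{M}=(S,\sim,V)$ with each $\sim_i$ an equivalence relation on $S$ and $V:\textsc{prop}\to 2^S$; in any model the group relation is $\sim_G=\bigcap_{i\in G}\sim_i$ (so in an updated model $(\sim|_{G_1}|\cdots|_{G_n})_H=\bigcap_{j\in H}(\sim|_{G_1}|\cdots|_{G_n})_j$). The $G$-resolved update is $\mathfrak{M}|_G=(S,\sim|_G,V)$ with $(\sim|_G)_i=\sim_G$ for $i\in G$ and $\sim_i$ otherwise. Satisfaction: atoms via $V$; Booleans as usual; $K_i\phi$ at $s$ iff $\phi$ at all $t$ with $s\sim_it$; $D_G\phi$ iff $\phi$ at all $t$ with $s\sim_Gt$; $C_G\phi$ iff $\phi$ at all $t$ reachable from $s$ via the reflexive transitive closure of $\bigcup_{i\in G}\sim_i$; $\mathfrak{M},s\models R_G\phi$ iff $\mathfrak{M}|_G,s\models\phi$. Valid = true at every state of every model. The function $\delta$: given a group $H$ and groups $G_1,\dots,G_n$, set $\delta_0=G_n\cup H$ if $G_n\cap H\neq\emptyset$ and $\delta_0=H$ otherwise; for $x=1,\dots,n-1$ set $\delta_x=G_{n-x}\cup\delta_{x-1}$ if $G_{n-x}\cap\delta_{x-1}\neq\emptyset$ and $\delta_x=\delta_{x-1}$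 otherwise; then $\delta(H,G_1,\dots,G_n)$ is the last of these, $\delta_{n-1}$. -}

module Defs where

open import Data.Nat using (ℕ; suc)
open import Data.Fin using (Fin)
open import Data.Fin.Subset using (Subset; _∈_; _∪_; _∩_; Nonempty; ⁅_⁆)
open import Data.Fin.Subset.Properties using (_∈?_; nonempty?; x∈⁅x⁆; q⊆p∪q)
open import Data.Bool using (if_then_else_)
open import Data.Product using (Σ; _×_; _,_; proj₁; proj₂)
open import Data.Empty using (⊥)
open import Data.Vec using (Vec; []; _∷_)
open import Relation.Nullary using (does)
open import Relation.Binary.Structures using (IsEquivalence)
open import Relation.Binary.Construct.Closure.ReflexiveTransitive using (Star)
open import Function.Bundles using (_⇔_)

Group : ℕ → Set
Group m = Σ (Subset m) Nonempty

singletonG : ∀ {m} → Fin m → Group m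
singletonG i = ⁅ i ⁆ , (i , x∈⁅x⁆ i)

-- Kripke structure (S, ∼, V); relations and valuations are Set-valued.
-- The state set S is a parameter, so updates visibly keep the same S.
record Structure (m : ℕ) (S : Set) : Set₁ where
  field
    rel : Fin m → S → S → Set
    V   : ℕ → S → Set
open Structure public

IsModel : ∀ {m S} → Structure m S → Set
IsModel {m} M = (i : Fin m) → IsEquivalence (rel M i)

groupRel : ∀ {m} {S : Set} → (Fin m → S → S → Set) → Subset m → S → S → Set
groupRel R G s t = ∀ i → i ∈ G → R i s t

update : ∀ {m S} → Structure m S → Group m → Structure m S
update M G = record
  { rel = λ i s t → if does (i ∈? proj₁ G) then groupRel (rel M) (proj₁ G) s t else rel M i s t
  ; V   = V M }

updates : ∀ {m n S} → Structure m S → Vec (Group m) n → Structure m S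
updates M []       = M
updates M (G ∷ Gs) = updates (update M G) Gs

data Form (m : ℕ) : Set where
  atom : ℕ → Form m
  ¬'_  : Form m → Form m
  _∧'_ : Form m → Form m → Form m
  K    : Fin m → Form m → Form m
  D    : Group m → Form m → Form m
  C    : Group m → Form m → Form m
  R    : Group m → Form m → Form m

Rs : ∀ {m n} → Vec (Group m) n → Form m → Form m
Rs []       φ = φ
Rs (G ∷ Gs) φ = R G (Rs Gs φ)

unionRel : ∀ {m S} (M : Structure m S) → Subset m → S → S → Set
unionRel M G s t = Σ _ λ i → (i ∈ G) × rel M i s t

_,_⊨_ : ∀ {m S} (M : Structure m S) → S → Form m → Set
M , s ⊨ atom p  = V M p s
M , s ⊨ (¬' φ)  = (M , s ⊨ φ) → ⊥
M , s ⊨ (φ ∧' ψ) = (M , s ⊨ φ) × (M , s ⊨ ψ)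
M , s ⊨ K i φ   = ∀ t → rel M i s t → M , t ⊨ φ
M , s ⊨ D G φ   = ∀ t → groupRel (rel M) (proj₁ G) s t → M , t ⊨ φ
M , s ⊨ C G φ   = ∀ t → Star (unionRel M (proj₁ G)) s t → M , t ⊨ φ
M , s ⊨ R G φ   = update M G , s ⊨ φ

ValidIff : ∀ {m} → Form m → Form m → Set₁
ValidIff {m} φ ψ = (S : Set) (M : Structure m S) → IsModel M → (s : S) → (M , s ⊨ φ) ⇔ (M , s ⊨ ψ)

δstep : ∀ {m} → Group m → Group m → Group m
δstep G acc = if does (nonempty? (proj₁ G ∩ proj₁ acc))
              then (proj₁ G ∪ proj₁ acc , (proj₁ (proj₂ acc) , q⊆p∪q (proj₁ G) (proj₁ acc) (proj₂ (proj₂ acc))))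
              else acc

δ : ∀ {m n} → Group m → Vec (Group m) n → Group m
δ H []       = H
δ H (G ∷ Gs) = δstep G (δ H Gs)

_≐_ : ∀ {A : Set} → (A → A → Set) → (A → A → Set) → Set
P ≐ Q = ∀ s t → P s t ⇔ Q s t

-- A resolved update by G replaces ∼ᵢ (i ∈ G) by ∼_G, so an intersection ∼_X of
-- updated relations is ∼_{G ∪ X} when X meets G (one agent of X already sees all
-- of ∼_G) and ∼_X when it does not. Iterating this along G₁, …, Gₙ, innermost
-- update last, is exactly the recursion defining δ; the two validities then
-- follow because R_{G₁}⋯R_{Gₙ} just evaluates in the updated model. Nothing
-- uses that the ∼ᵢ are equivalence relations.
module Submission where

open import Defs
open import Data.Nat using (ℕ; suc)
open import Data.Fin using (Fin)
open import Data.Vec using (Vec; []; _∷_)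
open import Data.Product using (_×_; proj₁; _,_)
open import Data.Sum using (inj₁; inj₂)
open import Data.Fin.Subset using (Subset; _∈_; _∉_; _∪_; _∩_; Empty; ⁅_⁆)
open import Data.Fin.Subset.Properties
  using (_∈?_; nonempty?; x∈p∩q⁺; x∈p∩q⁻; x∈p∪q⁺; x∈p∪q⁻; x∈⁅x⁆; x∈⁅y⁆⇒x≡y)
open import Relation.Nullary using (yes; no; contradiction)
open import Relation.Binary.PropositionalEquality using (subst; sym)
open import Function using (case_of_)
open import Function.Bundles using (_⇔_; mk⇔; Equivalence)
open import Function.Construct.Identity using (⇔-id)
open import Function.Construct.Symmetry using (⇔-sym)
open import Function.Construct.Composition using (_⇔-∘_)

open Equivalence using (to; from)

module _ {m : ℕ} {S : Set} (M : Structure m S) (G : Group m) where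

  update-rel-∈ : ∀ {i s t} → i ∈ proj₁ G →
    rel (update M G) i s t ⇔ groupRel (rel M) (proj₁ G) s t
  update-rel-∈ {i} i∈G with i ∈? proj₁ G
  ... | yes _   = ⇔-id _
  ... | no i∉G = contradiction i∈G i∉G

  update-rel-∉ : ∀ {i s t} → i ∉ proj₁ G → rel (update M G) i s t ⇔ rel M i s t
  update-rel-∉ {i} i∉G with i ∈? proj₁ G
  ... | yes i∈G = contradiction i∈G i∉G
  ... | no _    = ⇔-id _

  groupRel-update-overlapping : ∀ {k} (X : Subset m) → k ∈ proj₁ G → k ∈ X →
    groupRel (rel (update M G)) X ≐ groupRel (rel M) (proj₁ G ∪ X)
  groupRel-update-overlapping {k} X k∈G k∈X s t = mk⇔ narrow widen
    where
    narrow : groupRel (rel (update M G)) X s t → groupRel (rel M) (proj₁ G ∪ X) s t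
    narrow h j j∈G∪X with j ∈? proj₁ G | x∈p∪q⁻ (proj₁ G) X j∈G∪X
    ... | yes j∈G | _         = to (update-rel-∈ k∈G) (h k k∈X) j j∈G
    ... | no j∉G  | inj₁ j∈G  = contradiction j∈G j∉G
    ... | no j∉G  | inj₂ j∈X  = to (update-rel-∉ j∉G) (h j j∈X)

    widen : groupRel (rel M) (proj₁ G ∪ X) s t → groupRel (rel (update M G)) X s t
    widen h j j∈X = case j ∈? proj₁ G of λ where
      (yes j∈G) → from (update-rel-∈ j∈G) (λ l l∈G → h l (x∈p∪q⁺ (inj₁ l∈G)))
      (no j∉G)  → from (update-rel-∉ j∉G) (h j (x∈p∪q⁺ (inj₂ j∈X)))

  groupRel-update-disjoint : (X : Subset m) → Empty (proj₁ G ∩ X) →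
    groupRel (rel (update M G)) X ≐ groupRel (rel M) X
  groupRel-update-disjoint X disjoint s t = mk⇔
    (λ h j j∈X → to (update-rel-∉ (∉G j∈X)) (h j j∈X))
    (λ h j j∈X → from (update-rel-∉ (∉G j∈X)) (h j j∈X))
    where
    ∉G : ∀ {j} → j ∈ X → j ∉ proj₁ G
    ∉G j∈X j∈G = disjoint (_ , x∈p∩q⁺ (j∈G , j∈X))

  groupRel-update : (X : Group m) →
    groupRel (rel (update M G)) (proj₁ X) ≐ groupRel (rel M) (proj₁ (δstep G X))
  groupRel-update X with nonempty? (proj₁ G ∩ proj₁ X)
  ... | yes (k , k∈G∩X) =
    let k∈G , k∈X = x∈p∩q⁻ (proj₁ G) (proj₁ X) k∈G∩X
    in  groupRel-update-overlapping (proj₁ X) k∈G k∈X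
  ... | no disjoint = groupRel-update-disjoint (proj₁ X) disjoint

groupRel-updates : ∀ {m n S} (M : Structure m S) (Gs : Vec (Group m) n) (H : Group m) →
  groupRel (rel (updates M Gs)) (proj₁ H) ≐ groupRel (rel M) (proj₁ (δ H Gs))
groupRel-updates M []       H s t = ⇔-id _
groupRel-updates M (G ∷ Gs) H s t =
  groupRel-update M G (δ H Gs) s t ⇔-∘ groupRel-updates (update M G) Gs H s t

rel≐groupRel-⁅⁆ : ∀ {m} {S : Set} (Q : Fin m → S → S → Set) (i : Fin m) →
  Q i ≐ groupRel Q ⁅ i ⁆
rel≐groupRel-⁅⁆ Q i s t = mk⇔
  (λ q j j∈⁅i⁆ → subst (λ k → Q k s t) (sym (x∈⁅y⁆⇒x≡y i j∈⁅i⁆)) q)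
  (λ h → h i (x∈⁅x⁆ i))

rel-updates : ∀ {m n S} (M : Structure m S) (Gs : Vec (Group m) n) (i : Fin m) →
  rel (updates M Gs) i ≐ groupRel (rel M) (proj₁ (δ (singletonG i) Gs))
rel-updates M Gs i s t =
  groupRel-updates M Gs (singletonG i) s t ⇔-∘ rel≐groupRel-⁅⁆ (rel (updates M Gs)) i s t

⊨-Rs : ∀ {m n S} (M : Structure m S) (Gs : Vec (Group m) n) (s : S) (φ : Form m) →
  (M , s ⊨ Rs Gs φ) ⇔ (updates M Gs , s ⊨ φ)
⊨-Rs M []       s φ = ⇔-id _
⊨-Rs M (G ∷ Gs) s φ = ⊨-Rs (update M G) Gs s φ

□-cong : ∀ {S : Set} {P Q : S → S → Set} {A B : S → Set} (s : S) →
  P ≐ Q → (∀ t → A t ⇔ B t) → (∀ t → P s t → A t) ⇔ (∀ t → Q s t → B t)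
□-cong s P≐Q A⇔B = mk⇔
  (λ h t q → to (A⇔B t) (h t (from (P≐Q s t) q)))
  (λ h t p → from (A⇔B t) (h t (to (P≐Q s t) p)))

proposition7 : (m n : ℕ) (i : Fin m) (Gs : Vec (Group m) (suc n)) (H : Group m) →
    ((φ : Form m) → ValidIff (Rs Gs (K i φ)) (D (δ (singletonG i) Gs) (Rs Gs φ)))
    × ((φ : Form m) → ValidIff (Rs Gs (D H φ)) (D (δ H Gs) (Rs Gs φ)))
    × ((S : Set) (M : Structure m S) → IsModel M →
         rel (updates M Gs) i ≐ groupRel (rel M) (proj₁ (δ (singletonG i) Gs)))
    × ((S : Set) (M : Structure m S) → IsModel M →
         groupRel (rel (updates M Gs)) (proj₁ H) ≐ groupRel (rel M) (proj₁ (δ H Gs)))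
proposition7 m n i Gs H =
  (λ φ S M _ s → □-cong s (rel-updates M Gs i) (λ t → ⇔-sym (⊨-Rs M Gs t φ))
                   ⇔-∘ ⊨-Rs M Gs s (K i φ)) ,
  (λ φ S M _ s → □-cong s (groupRel-updates M Gs H) (λ t → ⇔-sym (⊨-Rs M Gs t φ))
                   ⇔-∘ ⊨-Rs M Gs s (D H φ)) ,
  (λ S M _ → rel-updates M Gs i) ,
  (λ S M _ → groupRel-updates M Gs H)
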